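{- Let $q>2$ be an odd integer. Then $f_{2,q}(n)=b_q(n)$ for every integer $n\ge1$.
   Context: $\mathbb{N}$ denotes the set of nonnegative integers. For an odd integer $q>2$, $f_{2,q}(n)$ denotes the number of different expressions of the positive integer $n$ as a sum of distinct terms taken from $\{2^{\alpha}q^{\beta}:\alpha,\beta\in\mathbb{N}\}$ (i.e. the number of finite subsets of this set whose elements sum to $n$). For an integer $m\ge2$, the $m$-ary partition function $b_m(n)$ is the number of partitions of $n$ into powers of $m$ (i.e. the number of ways to write $n=\sum_{i\ge0}a_i m^i$ with nonnegative integers $a_i$, order of parts irrelevant). -}

module Defs where

open import Data.Nat using (ℕ; zero; suc; _+_; _*_; _∸_; _^_; _≤?_; _≟_)
open import Data.List using (List; []; _∷_; map; upTo; concatMap; filter; deduplicate)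
open import Data.Nat.ListAction using (sum)
open import Relation.Nullary using (yes; no)

-- Number of subsets of (the elements of) a list whose elements sum to n.
-- Positions are counted, so the list must be duplicate-free to count subsets of a set.
distinctSums : List ℕ → ℕ → ℕ
distinctSums []       zero    = 1
distinctSums []       (suc _) = 0
distinctSums (x ∷ xs) n with x ≤? n
... | yes _ = distinctSums xs n + distinctSums xs (n ∸ x)
... | no  _ = distinctSums xs n

-- Number of multisets of elements of a (duplicate-free, positive) list summing to n,
-- i.e. the number of ways n = Σ a_x x with a_x ∈ ℕ.
multiSums : List ℕ → ℕ → ℕ
multiSums []       zero    = 1
multiSums []       (suc _) = 0
multiSums (x ∷ xs) n =
  sum (map (λ k → count k (k * x ≤? n)) (upTo (suc n)))
  where
  open import Relation.Nullary using (Dec)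
  open import Data.Nat using (_≤_)
  count : (k : ℕ) → Dec (k * x ≤ n) → ℕ
  count k (yes _) = multiSums xs (n ∸ k * x)
  count k (no  _) = 0

-- The elements of {2^α q^β : α, β ∈ ℕ} that are ≤ n, as a duplicate-free list.
-- (Any such element has α, β ≤ n, since 2^α > α and q^β > β for q ≥ 2.)
twoQTerms : ℕ → ℕ → List ℕ
twoQTerms q n =
  deduplicate _≟_
    (filter (_≤? n)
      (concatMap (λ α → map (λ β → 2 ^ α * q ^ β) (upTo (suc n))) (upTo (suc n))))

powersUpTo : ℕ → ℕ → List ℕ
powersUpTo m n = deduplicate _≟_ (filter (_≤? n) (map (m ^_) (upTo (suc n))))

-- f_{2,q}(n): number of finite subsets of {2^α q^β} summing to n.
-- (Elements > n can never occur in such a subset, so only terms ≤ n are listed.)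
f2q : ℕ → ℕ → ℕ
f2q q n = distinctSums (twoQTerms q n) n

bPart : ℕ → ℕ → ℕ
bPart m n = multiSums (powersUpTo m n) n

{-# OPTIONS --safe #-}

-- Since q is odd, the odd part of 2^α q^β is exactly q^β, so the terms split into the blocks
-- c, 2c, 4c, … with c = q^β, and f_{2,q} has generating function ∏_c ∏_α (1 + X^(2^α c)).
-- By uniqueness of binary expansions each inner product is 1/(1 - X^c), so the whole product
-- is ∏_c 1/(1 - X^c), the generating function of b_q. Coefficientwise up to degree N, the
-- block c, 2c, …, 2^(N-1) c satisfies the same recursion a n = r n + a (n - c) as a part c of
-- unbounded multiplicity, and this recursion determines a from r.

module Submission where

open import Defs
open import Data.Nat using (ℕ; _<_; _≤_)
open import Data.Nat.DivMod using (_%_)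
open import Relation.Binary.PropositionalEquality using (_≡_)

open import Data.Nat
  using (zero; suc; _+_; _*_; _∸_; _^_; _≰_; _≤?_; _≟_; z≤n; s≤s; z<s; s<s; NonZero; >-nonZero⁻¹)
open import Data.Nat.Properties
open import Data.Nat.DivMod using (%-distribˡ-*; m*n%n≡0)
open import Data.Nat.Induction using (<-rec)
open import Data.Nat.ListAction using (sum)
open import Data.Product using (Σ; ∃-syntax; ∃₂; _×_; _,_; proj₁; proj₂)
open import Function using (_∘_)
open import Function.Bundles using (mk⇔)
open import Relation.Nullary using (yes; no; contradiction)
open import Relation.Binary.PropositionalEquality
  using (_≢_; refl; sym; trans; cong; cong₂; subst; module ≡-Reasoning)
open import Algebra.Properties.CommutativeSemigroup +-commutativeSemigroup
  using (interchange; xy∙z≈xz∙y; xy∙z≈x∙zy)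

open import Data.List using (List; []; _∷_; _++_; map; concatMap; upTo; applyUpTo; filter)
open import Data.List.Properties using (map-upTo; filter-accept; filter-reject)
open import Data.List.Relation.Unary.All as All using (All; []; _∷_)
open import Data.List.Relation.Unary.AllPairs using ([]; _∷_)
open import Data.List.Relation.Unary.Any using (here; there)
open import Data.List.Relation.Unary.Unique.Propositional using (Unique)
open import Data.List.Relation.Unary.Unique.Propositional.Properties using (++⁺; filter⁺)
open import Data.List.Relation.Unary.Unique.DecPropositional.Properties _≟_ using (deduplicate-!)
open import Data.List.Relation.Binary.Disjoint.Propositional using (Disjoint)
open import Data.List.Relation.Binary.Permutation.Propositional as ↭ using (_↭_)
open import Data.List.Relation.Binary.BagAndSetEquality using (∼bag⇒↭)
open import Data.List.Membership.Propositional using (_∈_; find; lose)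
open import Data.List.Membership.Propositional.Properties
  using ( ∈-map⁺; ∈-map⁻; ∈-filter⁺; ∈-filter⁻; ∈-concatMap⁺; ∈-concatMap⁻; ∈-upTo⁺
        ; ∈-deduplicate⁺; ∈-deduplicate⁻)
open import Data.List.Membership.Propositional.Properties.WithK using (unique∧set⇒bag)

-- shift c a is the coefficient sequence of X^c · A(X), where A(X) = Σ a n X^n.
shift : ℕ → (ℕ → ℕ) → ℕ → ℕ
shift c a n with c ≤? n
... | yes _ = a (n ∸ c)
... | no  _ = 0

shift-≤ : ∀ {c n} (a : ℕ → ℕ) → c ≤ n → shift c a n ≡ a (n ∸ c)
shift-≤ {c} {n} a c≤n with c ≤? n
... | yes _   = refl
... | no  c≰n = contradiction c≤n c≰n

shift-≰ : ∀ {c n} (a : ℕ → ℕ) → c ≰ n → shift c a n ≡ 0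
shift-≰ {c} {n} a c≰n with c ≤? n
... | yes c≤n = contradiction c≤n c≰n
... | no  _   = refl

shift-cong : ∀ c n {a b : ℕ → ℕ} → (c ≤ n → a (n ∸ c) ≡ b (n ∸ c)) → shift c a n ≡ shift c b n
shift-cong c n eq with c ≤? n
... | yes c≤n = eq c≤n
... | no  _   = refl

shift-+ : ∀ c (a b : ℕ → ℕ) n → shift c (λ m → a m + b m) n ≡ shift c a n + shift c b n
shift-+ c a b n with c ≤? n
... | yes _ = refl
... | no  _ = refl

shift-shift : ∀ c d (a : ℕ → ℕ) n → shift c (shift d a) n ≡ shift (c + d) a n
shift-shift c d a n with c ≤? n
... | no c≰n = sym (shift-≰ a (c≰n ∘ m+n≤o⇒m≤o c))
... | yes c≤n with d ≤? n ∸ c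
...   | yes d≤n∸c = trans (cong a (∸-+-assoc n c d))
                      (sym (shift-≤ a (subst (_≤ n) (+-comm d c) (m≤o∸n⇒m+n≤o d c≤n d≤n∸c))))
...   | no  d≰n∸c = sym (shift-≰ a (d≰n∸c ∘ m+n≤o⇒m≤o∸n d ∘ subst (_≤ n) (+-comm c d)))

distinctSums-∷ : ∀ x xs n → distinctSums (x ∷ xs) n ≡ distinctSums xs n + shift x (distinctSums xs) n
distinctSums-∷ x xs n with x ≤? n
... | yes _ = refl
... | no  _ = sym (+-identityʳ _)

distinctSums-∷-≰ : ∀ {x n} xs → x ≰ n → distinctSums (x ∷ xs) n ≡ distinctSums xs n
distinctSums-∷-≰ {x} {n} xs x≰n with x ≤? n
... | yes x≤n = contradiction x≤n x≰n
... | no  _   = refl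

distinctSums-∷-cong : ∀ x {xs ys} n → (∀ m → m ≤ n → distinctSums xs m ≡ distinctSums ys m) →
                      distinctSums (x ∷ xs) n ≡ distinctSums (x ∷ ys) n
distinctSums-∷-cong x {xs} {ys} n eq = begin
  distinctSums (x ∷ xs) n
    ≡⟨ distinctSums-∷ x xs n ⟩
  distinctSums xs n + shift x (distinctSums xs) n
    ≡⟨ cong₂ _+_ (eq n ≤-refl) (shift-cong x n (λ _ → eq _ (m∸n≤m n x))) ⟩
  distinctSums ys n + shift x (distinctSums ys) n
    ≡⟨ distinctSums-∷ x ys n ⟨
  distinctSums (x ∷ ys) n
    ∎
  where open ≡-Reasoning

distinctSums-∷∷ : ∀ x y xs n → let d = distinctSums xs in
                  distinctSums (x ∷ y ∷ xs) n ≡ (d n + shift y d n) + (shift x d n + shift (x + y) d n)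
distinctSums-∷∷ x y xs n = begin
  distinctSums (x ∷ y ∷ xs) n
    ≡⟨ distinctSums-∷ x (y ∷ xs) n ⟩
  distinctSums (y ∷ xs) n + shift x (distinctSums (y ∷ xs)) n
    ≡⟨ cong₂ _+_ (distinctSums-∷ y xs n) (shift-cong x n (λ _ → distinctSums-∷ y xs _)) ⟩
  (d n + shift y d n) + shift x (λ m → d m + shift y d m) n
    ≡⟨ cong (d n + shift y d n +_) (shift-+ x d (shift y d) n) ⟩
  (d n + shift y d n) + (shift x d n + shift x (shift y d) n)
    ≡⟨ cong (λ t → d n + shift y d n + (shift x d n + t)) (shift-shift x y d n) ⟩
  (d n + shift y d n) + (shift x d n + shift (x + y) d n)
    ∎
  where
  open ≡-Reasoning
  d : ℕ → ℕ
  d = distinctSums xs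

distinctSums-swap : ∀ x y xs n → distinctSums (x ∷ y ∷ xs) n ≡ distinctSums (y ∷ x ∷ xs) n
distinctSums-swap x y xs n = begin
  distinctSums (x ∷ y ∷ xs) n
    ≡⟨ distinctSums-∷∷ x y xs n ⟩
  (d n + shift y d n) + (shift x d n + shift (x + y) d n)
    ≡⟨ interchange (d n) (shift y d n) (shift x d n) _ ⟩
  (d n + shift x d n) + (shift y d n + shift (x + y) d n)
    ≡⟨ cong (λ t → d n + shift x d n + (shift y d n + shift t d n)) (+-comm x y) ⟩
  (d n + shift x d n) + (shift y d n + shift (y + x) d n)
    ≡⟨ distinctSums-∷∷ y x xs n ⟨
  distinctSums (y ∷ x ∷ xs) n
    ∎
  where
  open ≡-Reasoning
  d : ℕ → ℕ
  d = distinctSums xs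

distinctSums-↭ : ∀ {xs ys} → xs ↭ ys → ∀ n → distinctSums xs n ≡ distinctSums ys n
distinctSums-↭ ↭.refl          n = refl
distinctSums-↭ (↭.prep x p)    n = distinctSums-∷-cong x n (λ m _ → distinctSums-↭ p m)
distinctSums-↭ (↭.swap x y p)  n = trans (distinctSums-swap x y _ n)
  (distinctSums-∷-cong y n (λ m _ → distinctSums-∷-cong x m (λ k _ → distinctSums-↭ p k)))
distinctSums-↭ (↭.trans p p′) n = trans (distinctSums-↭ p n) (distinctSums-↭ p′ n)

distinctSums-filter : ∀ N xs {n} → n ≤ N → distinctSums (filter (_≤? N) xs) n ≡ distinctSums xs n
distinctSums-filter N []       _   = refl
distinctSums-filter N (x ∷ xs) {n} n≤N with x ≤? N
... | yes x≤N = trans (cong (λ l → distinctSums l n) (filter-accept (_≤? N) x≤N))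
                  (distinctSums-∷-cong x n (λ m m≤n → distinctSums-filter N xs (≤-trans m≤n n≤N)))
... | no  x≰N = trans (cong (λ l → distinctSums l n) (filter-reject (_≤? N) x≰N))
                  (trans (distinctSums-filter N xs n≤N)
                    (sym (distinctSums-∷-≰ xs (λ x≤n → x≰N (≤-trans x≤n n≤N)))))

sum-applyUpTo-cong : ∀ {f g : ℕ → ℕ} m → (∀ k → f k ≡ g k) → sum (applyUpTo f m) ≡ sum (applyUpTo g m)
sum-applyUpTo-cong zero    eq = refl
sum-applyUpTo-cong (suc m) eq = cong₂ _+_ (eq 0) (sum-applyUpTo-cong m (eq ∘ suc))

sum-applyUpTo-vanishing : ∀ {f : ℕ → ℕ} {m} m′ → (∀ k → m ≤ k → f k ≡ 0) → m ≤ m′ →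
                          sum (applyUpTo f m′) ≡ sum (applyUpTo f m)
sum-applyUpTo-vanishing             zero     _   z≤n        = refl
sum-applyUpTo-vanishing {m = zero}  (suc m′) f≡0 z≤n        =
  cong₂ _+_ (f≡0 0 z≤n) (sum-applyUpTo-vanishing m′ (λ k _ → f≡0 (suc k) z≤n) z≤n)
sum-applyUpTo-vanishing {m = suc m} (suc m′) f≡0 (s≤s m≤m′) =
  cong (_ +_) (sum-applyUpTo-vanishing m′ (λ k m≤k → f≡0 (suc k) (s≤s m≤k)) m≤m′)

-- The summand of multiSums is a where-bound function of Defs and cannot be named
-- here; unifying against the unfolded definition recovers it.
multiSums-summand : ℕ → List ℕ → ℕ → ℕ → ℕ
multiSums-summand x xs n = proj₁ unfolded
  where
  unfolded : Σ (ℕ → ℕ) λ t → multiSums (x ∷ xs) n ≡ sum (map t (upTo (suc n)))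
  unfolded = _ , refl

multiSums-∷-sum : ∀ x xs n → multiSums (x ∷ xs) n ≡ sum (applyUpTo (multiSums-summand x xs n) (suc n))
multiSums-∷-sum x xs n = cong sum (map-upTo (multiSums-summand x xs n) (suc n))

multiSums-summand-≤ : ∀ x xs n k → k * x ≤ n → multiSums-summand x xs n k ≡ multiSums xs (n ∸ k * x)
multiSums-summand-≤ x xs n k kx≤n with k * x ≤? n
... | yes _    = refl
... | no  kx≰n = contradiction kx≤n kx≰n

multiSums-summand-≰ : ∀ x xs n k → k * x ≰ n → multiSums-summand x xs n k ≡ 0
multiSums-summand-≰ x xs n k kx≰n with k * x ≤? n
... | yes kx≤n = contradiction kx≤n kx≰n
... | no  _    = refl

module _ (x : ℕ) (xs : List ℕ) where

  private
    summand : ℕ → ℕ → ℕ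
    summand = multiSums-summand x xs

  multiSums-summand-suc : ∀ {n} k → x ≤ n → summand n (suc k) ≡ summand (n ∸ x) k
  multiSums-summand-suc {n} k x≤n with k * x ≤? n ∸ x
  ... | yes kx≤n∸x = trans (multiSums-summand-≤ x xs n (suc k) x+kx≤n)
                       (cong (multiSums xs) (sym (∸-+-assoc n x (k * x))))
    where
    x+kx≤n : x + k * x ≤ n
    x+kx≤n = subst (_≤ n) (+-comm (k * x) x) (m≤o∸n⇒m+n≤o (k * x) x≤n kx≤n∸x)
  ... | no  kx≰n∸x = multiSums-summand-≰ x xs n (suc k)
                       (kx≰n∸x ∘ m+n≤o⇒m≤o∸n (k * x) ∘ subst (_≤ n) (+-comm x (k * x)))

  multiSums-summand-suc-≰ : ∀ {n} k → x ≰ n → summand n (suc k) ≡ 0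
  multiSums-summand-suc-≰ {n} k x≰n = multiSums-summand-≰ x xs n (suc k) (x≰n ∘ m+n≤o⇒m≤o x)

  multiSums-summand-< : ∀ {n} k → .{{NonZero x}} → n < k → summand n k ≡ 0
  multiSums-summand-< {n} k n<k = multiSums-summand-≰ x xs n k (<⇒≱ n<k ∘ ≤-trans (m≤m*n k x))

  multiSums-∷ : ∀ n → .{{NonZero x}} →
                multiSums (x ∷ xs) n ≡ multiSums xs n + shift x (multiSums (x ∷ xs)) n
  multiSums-∷ n = begin
    multiSums (x ∷ xs) n
      ≡⟨ multiSums-∷-sum x xs n ⟩
    summand n 0 + sum (applyUpTo (summand n ∘ suc) n)
      ≡⟨ cong₂ _+_ (multiSums-summand-≤ x xs n 0 z≤n) tail ⟩
    multiSums xs n + shift x (multiSums (x ∷ xs)) n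
      ∎
    where
    open ≡-Reasoning
    tail : sum (applyUpTo (summand n ∘ suc) n) ≡ shift x (multiSums (x ∷ xs)) n
    tail with x ≤? n
    ... | no  x≰n = sum-applyUpTo-vanishing n (λ k _ → multiSums-summand-suc-≰ k x≰n) z≤n
    ... | yes x≤n = begin
      sum (applyUpTo (summand n ∘ suc) n)
        ≡⟨ sum-applyUpTo-cong n (λ k → multiSums-summand-suc k x≤n) ⟩
      sum (applyUpTo (summand (n ∸ x)) n)
        ≡⟨ sum-applyUpTo-vanishing n (λ k → multiSums-summand-< k) n∸x<n ⟩
      sum (applyUpTo (summand (n ∸ x)) (suc (n ∸ x)))
        ≡⟨ multiSums-∷-sum x xs (n ∸ x) ⟨
      multiSums (x ∷ xs) (n ∸ x)
        ∎
      where
      n∸x<n : n ∸ x < n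
      n∸x<n = ∸-monoʳ-< (>-nonZero⁻¹ x) x≤n

shift-fixpoint-unique : ∀ c N {r a b : ℕ → ℕ} → .{{NonZero c}} →
                        (∀ n → n ≤ N → a n ≡ r n + shift c a n) →
                        (∀ n → n ≤ N → b n ≡ r n + shift c b n) →
                        ∀ n → n ≤ N → a n ≡ b n
shift-fixpoint-unique c N {r} {a} {b} a-eq b-eq = <-rec (λ n → n ≤ N → a n ≡ b n) step
  where
  step : ∀ n → (∀ {m} → m < n → m ≤ N → a m ≡ b m) → n ≤ N → a n ≡ b n
  step n ih n≤N = begin
    a n               ≡⟨ a-eq n n≤N ⟩
    r n + shift c a n ≡⟨ cong (r n +_) (shift-cong c n (λ c≤n → ih (∸-monoʳ-< (>-nonZero⁻¹ c) c≤n)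
                                                                 (≤-trans (m∸n≤m n c) n≤N))) ⟩
    r n + shift c b n ≡⟨ b-eq n n≤N ⟨
    b n               ∎
    where open ≡-Reasoning

doublings : ℕ → ℕ → List ℕ
doublings c zero    = []
doublings c (suc K) = c ∷ doublings (2 * c) K

2^a*[2*c]≡2^[1+a]*c : ∀ a c → 2 ^ a * (2 * c) ≡ 2 ^ suc a * c
2^a*[2*c]≡2^[1+a]*c a c = trans (sym (*-assoc (2 ^ a) 2 c)) (cong (_* c) (*-comm (2 ^ a) 2))

-- The telescoping identity (1 + X^c)(1 + X^2c)⋯(1 + X^(2^(K-1) c)) · (1 - X^c) = 1 - X^(2^K c),
-- multiplied by the series of distinctSums R.
distinctSums-doublings : ∀ K c R n →
  distinctSums (doublings c K ++ R) n + shift (2 ^ K * c) (distinctSums R) n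
    ≡ distinctSums R n + shift c (distinctSums (doublings c K ++ R)) n
distinctSums-doublings zero    c R n =
  cong (λ t → distinctSums R n + shift t (distinctSums R) n) (*-identityˡ c)
distinctSums-doublings (suc K) c R n = begin
  distinctSums (c ∷ L) n + shift (2 ^ suc K * c) d n
    ≡⟨ cong₂ _+_ (distinctSums-∷ c L n) (cong (λ t → shift t d n) (sym (2^a*[2*c]≡2^[1+a]*c K c))) ⟩
  (e n + shift c e n) + shift (2 ^ K * (2 * c)) d n
    ≡⟨ xy∙z≈xz∙y (e n) _ _ ⟩
  (e n + shift (2 ^ K * (2 * c)) d n) + shift c e n
    ≡⟨ cong (_+ shift c e n) (distinctSums-doublings K (2 * c) R n) ⟩
  (d n + shift (2 * c) e n) + shift c e n
    ≡⟨ xy∙z≈x∙zy (d n) _ _ ⟩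
  d n + (shift c e n + shift (2 * c) e n)
    ≡⟨ cong (λ t → d n + (shift c e n + shift t e n)) c+c≡2*c ⟨
  d n + (shift c e n + shift (c + c) e n)
    ≡⟨ cong (λ t → d n + (shift c e n + t)) (shift-shift c c e n) ⟨
  d n + (shift c e n + shift c (shift c e) n)
    ≡⟨ cong (d n +_) (shift-+ c e (shift c e) n) ⟨
  d n + shift c (λ m → e m + shift c e m) n
    ≡⟨ cong (d n +_) (shift-cong c n (λ _ → distinctSums-∷ c L _)) ⟨
  d n + shift c (distinctSums (c ∷ L)) n
    ∎
  where
  open ≡-Reasoning
  L : List ℕ
  L = doublings (2 * c) K ++ R
  d e : ℕ → ℕ
  d = distinctSums R
  e = distinctSums L
  c+c≡2*c : c + c ≡ 2 * c
  c+c≡2*c = cong (c +_) (sym (+-identityʳ c))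

distinctSums-doublings-< : ∀ K c R n → n < 2 ^ K * c →
  distinctSums (doublings c K ++ R) n ≡ distinctSums R n + shift c (distinctSums (doublings c K ++ R)) n
distinctSums-doublings-< K c R n n<2^Kc =
  trans (sym (trans (cong (distinctSums (doublings c K ++ R) n +_) (shift-≰ (distinctSums R) (<⇒≱ n<2^Kc)))
                    (+-identityʳ _)))
        (distinctSums-doublings K c R n)

concatDoublings : ℕ → List ℕ → List ℕ
concatDoublings K = concatMap (λ c → doublings c K)

distinctSums-concatDoublings : ∀ {K N} → N < 2 ^ K → ∀ cs → All NonZero cs →
                               ∀ n → n ≤ N → distinctSums (concatDoublings K cs) n ≡ multiSums cs n
distinctSums-concatDoublings _ [] [] zero    _ = refl
distinctSums-concatDoublings _ [] [] (suc n) _ = refl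
distinctSums-concatDoublings {K} {N} N<2^K (c ∷ cs) (c≢0 ∷ cs≢0) =
  shift-fixpoint-unique c N {{c≢0}}
    (λ n n≤N → distinctSums-doublings-< K c R n
                  (<-≤-trans (≤-<-trans n≤N N<2^K) (m≤m*n (2 ^ K) c {{c≢0}})))
    (λ n n≤N → trans (multiSums-∷ c cs n {{c≢0}}) (cong (_+ _) (sym (ih n n≤N))))
  where
  R : List ℕ
  R = concatDoublings K cs
  ih : ∀ n → n ≤ N → distinctSums R n ≡ multiSums cs n
  ih = distinctSums-concatDoublings N<2^K cs cs≢0

Odd : ℕ → Set
Odd n = n % 2 ≡ 1

odd-^ : ∀ {q} → Odd q → ∀ b → Odd (q ^ b)
odd-^ q-odd zero        = refl
odd-^ {q} q-odd (suc b) = begin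
  (q * q ^ b) % 2               ≡⟨ %-distribˡ-* q (q ^ b) 2 ⟩
  ((q % 2) * (q ^ b % 2)) % 2   ≡⟨ cong₂ (λ u v → (u * v) % 2) q-odd (odd-^ q-odd b) ⟩
  1                             ∎
  where open ≡-Reasoning

odd⇒nonZero : ∀ {c} → Odd c → NonZero c
odd⇒nonZero {suc _} _ = _

odd≢2* : ∀ {c} m → Odd c → c ≢ 2 * m
odd≢2* m c-odd c≡2m =
  1+n≢0 (trans (sym c-odd) (trans (cong (_% 2) (trans c≡2m (*-comm 2 m))) (m*n%n≡0 m 2)))

2^a*odd-injective : ∀ a a′ {c c′} → Odd c → Odd c′ → 2 ^ a * c ≡ 2 ^ a′ * c′ → c ≡ c′
2^a*odd-injective zero    zero     {c} {c′} _     _      eq = *-cancelˡ-≡ c c′ 1 eq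
2^a*odd-injective zero    (suc a′) {c} {c′} c-odd _      eq =
  contradiction (trans (sym (*-identityˡ c)) (trans eq (*-assoc 2 (2 ^ a′) c′))) (odd≢2* (2 ^ a′ * c′) c-odd)
2^a*odd-injective (suc a) zero     {c} {c′} _     c′-odd eq =
  contradiction (trans (sym (*-identityˡ c′)) (trans (sym eq) (*-assoc 2 (2 ^ a) c))) (odd≢2* (2 ^ a * c) c′-odd)
2^a*odd-injective (suc a) (suc a′) {c} {c′} c-odd c′-odd eq =
  2^a*odd-injective a a′ c-odd c′-odd (*-cancelˡ-≡ (2 ^ a * c) (2 ^ a′ * c′) 2
    (trans (sym (*-assoc 2 (2 ^ a) c)) (trans eq (*-assoc 2 (2 ^ a′) c′))))

∈-doublings⁻ : ∀ c K {z} → z ∈ doublings c K → ∃[ a ] a < K × z ≡ 2 ^ a * c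
∈-doublings⁻ c (suc K) (here z≡c) = 0 , z<s , trans z≡c (sym (*-identityˡ c))
∈-doublings⁻ c (suc K) (there z∈) with ∈-doublings⁻ (2 * c) K z∈
... | a , a<K , z≡ = suc a , s<s a<K , trans z≡ (2^a*[2*c]≡2^[1+a]*c a c)

∈-doublings⁺ : ∀ c K {a} → a < K → 2 ^ a * c ∈ doublings c K
∈-doublings⁺ c (suc K) {zero}  _         = here (*-identityˡ c)
∈-doublings⁺ c (suc K) {suc a} (s<s a<K) =
  there (subst (_∈ doublings (2 * c) K) (2^a*[2*c]≡2^[1+a]*c a c) (∈-doublings⁺ (2 * c) K a<K))

doublings-≥ : ∀ c K {z} → z ∈ doublings c K → c ≤ z
doublings-≥ c (suc K) (here z≡c) = ≤-reflexive (sym z≡c)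
doublings-≥ c (suc K) (there z∈) = ≤-trans (m≤m+n c (c + 0)) (doublings-≥ (2 * c) K z∈)

doublings-unique : ∀ c K → .{{NonZero c}} → Unique (doublings c K)
doublings-unique c         zero    = []
doublings-unique c@(suc _) (suc K) = All.tabulate c≢ ∷ doublings-unique (2 * c) K
  where
  c≢ : ∀ {z} → z ∈ doublings (2 * c) K → c ≢ z
  c≢ z∈ c≡z = <⇒≱ (m<m+n c z<s) (subst (2 * c ≤_) (sym c≡z) (doublings-≥ (2 * c) K z∈))

∈-concatDoublings⁻ : ∀ K cs {z} → z ∈ concatDoublings K cs → ∃[ c ] c ∈ cs × z ∈ doublings c K
∈-concatDoublings⁻ K cs z∈ = find (∈-concatMap⁻ (λ c → doublings c K) z∈)

∈-concatDoublings⁺ : ∀ K {cs c z} → c ∈ cs → z ∈ doublings c K → z ∈ concatDoublings K cs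
∈-concatDoublings⁺ K c∈ z∈ = ∈-concatMap⁺ (λ c → doublings c K) (lose c∈ z∈)

concatDoublings-unique : ∀ K {cs} → Unique cs → All Odd cs → Unique (concatDoublings K cs)
concatDoublings-unique K []            []               = []
concatDoublings-unique K {c ∷ cs} (c∉cs ∷ cs!) (c-odd ∷ cs-odd) =
  ++⁺ (doublings-unique c K {{odd⇒nonZero c-odd}}) (concatDoublings-unique K cs! cs-odd) disjoint
  where
  disjoint : Disjoint (doublings c K) (concatDoublings K cs)
  disjoint (z∈c , z∈cs) with ∈-concatDoublings⁻ K cs z∈cs
  ... | c′ , c′∈cs , z∈c′ with ∈-doublings⁻ c K z∈c | ∈-doublings⁻ c′ K z∈c′
  ...   | a , _ , z≡ | a′ , _ , z≡′ =
    All.lookup c∉cs c′∈cs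
      (2^a*odd-injective a a′ c-odd (All.lookup cs-odd c′∈cs) (trans (sym z≡) z≡′))

n<m^n : ∀ {m} → 1 < m → ∀ n → n < m ^ n
n<m^n 1<m zero        = s≤s z≤n
n<m^n {m} 1<m (suc n) = begin
  1 + suc n       ≤⟨ +-mono-≤ (≤-trans (s≤s z≤n) ih) ih ⟩
  m ^ n + m ^ n   ≡⟨ cong (m ^ n +_) (+-identityʳ (m ^ n)) ⟨
  2 * m ^ n       ≤⟨ *-monoˡ-≤ (m ^ n) 1<m ⟩
  m * m ^ n       ∎
  where
  open ≤-Reasoning
  ih : n < m ^ n
  ih = n<m^n 1<m n

TwoQTerm : ℕ → ℕ → Set
TwoQTerm q z = ∃₂ λ α β → z ≡ 2 ^ α * q ^ β

exponents-< : ∀ {q N} → 1 < q → ∀ α β → 2 ^ α * q ^ β ≤ N → α < N × β < N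
exponents-< {q@(suc _)} 1<q α β z≤N =
  <-≤-trans (n<m^n {2} ≤-refl α) (≤-trans (m≤m*n (2 ^ α) (q ^ β) {{m^n≢0 q β}}) z≤N) ,
  <-≤-trans (n<m^n 1<q β) (≤-trans (m≤n*m (q ^ β) (2 ^ α) {{m^n≢0 2 α}}) z≤N)

module _ (q N : ℕ) where

  private
    powers : List ℕ
    powers = map (q ^_) (upTo (suc N))

    row : ℕ → List ℕ
    row α = map (λ β → 2 ^ α * q ^ β) (upTo (suc N))

    grid : List ℕ
    grid = concatMap row (upTo (suc N))

  ∈-powersUpTo⁻ : ∀ {c} → c ∈ powersUpTo q N → ∃[ β ] c ≡ q ^ β
  ∈-powersUpTo⁻ c∈ =
    let c∈powers , _ = ∈-filter⁻ (_≤? N) {xs = powers} (∈-deduplicate⁻ _≟_ (filter (_≤? N) powers) c∈)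
        β , _ , c≡   = ∈-map⁻ (q ^_) {xs = upTo (suc N)} c∈powers
    in β , c≡

  ∈-powersUpTo⁺ : 1 < q → ∀ β → q ^ β ≤ N → q ^ β ∈ powersUpTo q N
  ∈-powersUpTo⁺ 1<q β q^β≤N =
    ∈-deduplicate⁺ _≟_ (∈-filter⁺ (_≤? N) (∈-map⁺ (q ^_) (∈-upTo⁺ (s≤s (<⇒≤ β<N)))) q^β≤N)
    where
    β<N : β < N
    β<N = <-≤-trans (n<m^n 1<q β) q^β≤N

  ∈-twoQTerms⁻ : ∀ {z} → z ∈ twoQTerms q N → z ≤ N × TwoQTerm q z
  ∈-twoQTerms⁻ z∈ =
    let z∈grid , z≤N = ∈-filter⁻ (_≤? N) {xs = grid} (∈-deduplicate⁻ _≟_ (filter (_≤? N) grid) z∈)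
        α , _ , z∈row = find (∈-concatMap⁻ row {upTo (suc N)} z∈grid)
        β , _ , z≡    = ∈-map⁻ (λ β → 2 ^ α * q ^ β) {xs = upTo (suc N)} z∈row
    in z≤N , α , β , z≡

  ∈-twoQTerms⁺ : ∀ {z} → 1 < q → z ≤ N → TwoQTerm q z → z ∈ twoQTerms q N
  ∈-twoQTerms⁺ 1<q z≤N (α , β , refl) = ∈-deduplicate⁺ _≟_ (∈-filter⁺ (_≤? N) z∈grid z≤N)
    where
    α<N : α < N
    α<N = proj₁ (exponents-< 1<q α β z≤N)
    β<N : β < N
    β<N = proj₂ (exponents-< 1<q α β z≤N)
    z∈grid : 2 ^ α * q ^ β ∈ grid
    z∈grid = ∈-concatMap⁺ row
      (lose (∈-upTo⁺ (s≤s (<⇒≤ α<N))) (∈-map⁺ (λ β → 2 ^ α * q ^ β) (∈-upTo⁺ (s≤s (<⇒≤ β<N)))))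

twoQTermsByOddPart : ℕ → ℕ → List ℕ
twoQTermsByOddPart q N = filter (_≤? N) (concatDoublings N (powersUpTo q N))

∈-twoQTermsByOddPart⁻ : ∀ q N {z} → z ∈ twoQTermsByOddPart q N → z ≤ N × TwoQTerm q z
∈-twoQTermsByOddPart⁻ q N z∈ with ∈-filter⁻ (_≤? N) z∈
... | z∈′ , z≤N with ∈-concatDoublings⁻ N (powersUpTo q N) z∈′
...   | c , c∈ , z∈c with ∈-powersUpTo⁻ q N c∈ | ∈-doublings⁻ c N z∈c
...     | β , refl | α , _ , z≡ = z≤N , α , β , z≡

∈-twoQTermsByOddPart⁺ : ∀ q N {z} → 1 < q → z ≤ N → TwoQTerm q z → z ∈ twoQTermsByOddPart q N
∈-twoQTermsByOddPart⁺ q@(suc _) N 1<q z≤N (α , β , refl) =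
  ∈-filter⁺ (_≤? N)
    (∈-concatDoublings⁺ N (∈-powersUpTo⁺ q N 1<q β q^β≤N) (∈-doublings⁺ (q ^ β) N α<N)) z≤N
  where
  α<N : α < N
  α<N = proj₁ (exponents-< 1<q α β z≤N)
  q^β≤N : q ^ β ≤ N
  q^β≤N = ≤-trans (m≤n*m (q ^ β) (2 ^ α) {{m^n≢0 2 α}}) z≤N

powersUpTo-odd : ∀ {q} → Odd q → ∀ N → All Odd (powersUpTo q N)
powersUpTo-odd {q} q-odd N = All.tabulate λ c∈ → odd-of (∈-powersUpTo⁻ q N c∈)
  where
  odd-of : ∀ {c} → ∃[ β ] c ≡ q ^ β → Odd c
  odd-of (β , refl) = odd-^ q-odd β

twoQTerms↭twoQTermsByOddPart : ∀ {q} → 1 < q → Odd q → ∀ N → twoQTerms q N ↭ twoQTermsByOddPart q N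
twoQTerms↭twoQTermsByOddPart {q} 1<q q-odd N =
  ∼bag⇒↭ (unique∧set⇒bag (deduplicate-! _) byOddPart-unique (mk⇔ to from))
  where
  byOddPart-unique : Unique (twoQTermsByOddPart q N)
  byOddPart-unique = filter⁺ (_≤? N) (concatDoublings-unique N (deduplicate-! _) (powersUpTo-odd q-odd N))
  to : ∀ {z} → z ∈ twoQTerms q N → z ∈ twoQTermsByOddPart q N
  to z∈ = let z≤N , t = ∈-twoQTerms⁻ q N z∈ in ∈-twoQTermsByOddPart⁺ q N 1<q z≤N t
  from : ∀ {z} → z ∈ twoQTermsByOddPart q N → z ∈ twoQTerms q N
  from z∈ = let z≤N , t = ∈-twoQTermsByOddPart⁻ q N z∈ in ∈-twoQTerms⁺ q N 1<q z≤N t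

proposition1 : (q : ℕ) → 2 < q → q % 2 ≡ 1 → (n : ℕ) → 1 ≤ n → f2q q n ≡ bPart q n
proposition1 q 2<q q-odd N _ = begin
  distinctSums (twoQTerms q N) N
    ≡⟨ distinctSums-↭ (twoQTerms↭twoQTermsByOddPart 1<q q-odd N) N ⟩
  distinctSums (twoQTermsByOddPart q N) N
    ≡⟨ distinctSums-filter N (concatDoublings N (powersUpTo q N)) ≤-refl ⟩
  distinctSums (concatDoublings N (powersUpTo q N)) N
    ≡⟨ distinctSums-concatDoublings (n<m^n {2} ≤-refl N) (powersUpTo q N)
         (All.map odd⇒nonZero (powersUpTo-odd q-odd N)) N ≤-refl ⟩
  multiSums (powersUpTo q N) N
    ∎
  where
  open ≡-Reasoning
  1<q : 1 < q
  1<q = <-trans (n<1+n 1) 2<q
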